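{- Let $k\geq 2$ be an integer. Let $q$ be a prime power such that $q\equiv 1\pmod k$ if $q$ is even, or $q\equiv 1\pmod{2k}$ if $q$ is odd. Let $H_k(q)$ be the induced subgraph of $G_k(q)$ on the set of $k$-th power residues of $\mathbb{F}_q$. Then \[ \mathcal{K}_3(G_k(q))=\frac{q}{3}\,\#E(H_k(q)). \]
   Context: $\mathcal{K}_m(G)$ is the number of complete subgraphs of order $m$ in $G$; $E(G)$ is the edge set. $S_k$ is the subgroup of $\mathbb{F}_q^*$ of order $\frac{q-1}{k}$ of $k$-th power residues, and the generalized Paley graph $G_k(q)$ has vertex set $\mathbb{F}_q$ with $ab$ an edge iff $a-b\in S_k$. -}

module Defs where

open import Level using (0ℓ)
open import Data.Nat using (ℕ; zero; suc; _<_; _<?_)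
open import Data.Fin using (Fin; toℕ)
open import Data.Fin.Properties using () renaming (_≟_ to _≟ᶠ_)
open import Data.List using (List; []; _∷_; length; filter; allFin; concatMap; map)
open import Data.Product using (_×_; _,_; ∃; proj₁; proj₂)
open import Relation.Nullary using (¬_; Dec; yes; no)
open import Relation.Nullary.Decidable using (_×-dec_; ¬?; map′)
open import Relation.Unary using (Pred; Decidable)
open import Relation.Binary.PropositionalEquality using (_≡_; _≢_; refl; cong; sym; trans)
open import Algebra.Core using (Op₁; Op₂)
open import Algebra.Structures using (IsCommutativeRing)
open import Function.Bundles using (_↔_; Inverse)

record FiniteField (q : ℕ) : Set₁ where
  infixl 7 _*_
  infixl 6 _+_ _-_
  field
    F                 : Set
    _+_               : Op₂ F
    _*_               : Op₂ F
    -_                : Op₁ F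
    0#                : F
    1#                : F
    isCommutativeRing : IsCommutativeRing _≡_ _+_ _*_ -_ 0# 1#
    0≢1               : 0# ≢ 1#
    inverse           : ∀ x → x ≢ 0# → ∃ λ y → x * y ≡ 1#
    enum              : Fin q ↔ F

  _-_ : Op₂ F
  x - y = x + (- y)

  _^_ : F → ℕ → F
  x ^ zero  = 1#
  x ^ suc n = x * (x ^ n)

  elt : Fin q → F
  elt = Inverse.to enum

  idx : F → Fin q
  idx = Inverse.from enum

  _≟_ : (x y : F) → Dec (x ≡ y)
  x ≟ y = map′ (λ e → trans (sym (Inverse.strictlyInverseˡ enum x))
                        (trans (cong elt e) (Inverse.strictlyInverseˡ enum y)))
               (cong idx) (idx x ≟ᶠ idx y)

  S : ℕ → Pred F 0ℓ
  S k x = x ≢ 0# × ∃ λ y → y ^ k ≡ x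

  S? : (k : ℕ) → Decidable (S k)
  S? k x = ¬? (x ≟ 0#) ×-dec
           map′ (λ { (i , e) → elt i , e }) (λ { (y , e) → idx y , trans (cong (_^ k) (Inverse.strictlyInverseˡ enum y)) e })
                (Data.Fin.Properties.any? λ i → (elt i ^ k) ≟ x)
    where import Data.Fin.Properties

  -- adjacency in the generalized Paley graph G_k(q): a ~ b iff a - b ∈ S_k
  Adj : ℕ → F → F → Set
  Adj k a b = S k (a - b)

  Adj? : (k : ℕ) → (a b : F) → Dec (Adj k a b)
  Adj? k a b = S? k (a - b)

count : {A : Set} {P : Pred A 0ℓ} → Decidable P → List A → ℕ
count P? xs = length (filter P? xs)

pairs : (q : ℕ) → List (Fin q × Fin q)
pairs q = concatMap (λ i → map (λ j → i , j) (allFin q)) (allFin q)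

triples : (q : ℕ) → List (Fin q × Fin q × Fin q)
triples q = concatMap (λ i → concatMap (λ j → map (λ l → i , j , l) (allFin q)) (allFin q)) (allFin q)

module _ {q : ℕ} (𝔽 : FiniteField q) (k : ℕ) where
  open FiniteField 𝔽

  -- an unordered triangle {a,b,c} of G_k(q), listed once via indices i < j < l
  IsTriangle : Pred (Fin q × Fin q × Fin q) 0ℓ
  IsTriangle (i , j , l) =
    (toℕ i < toℕ j × toℕ j < toℕ l) ×
    (Adj k (elt i) (elt j) × Adj k (elt i) (elt l) × Adj k (elt j) (elt l))

  IsTriangle? : Decidable IsTriangle
  IsTriangle? (i , j , l) =
    ((toℕ i <? toℕ j) ×-dec (toℕ j <? toℕ l)) ×-dec
    (Adj? k (elt i) (elt j) ×-dec Adj? k (elt i) (elt l) ×-dec Adj? k (elt j) (elt l))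

  K₃ : ℕ
  K₃ = count IsTriangle? (triples q)

  -- an (unordered) edge {a,b} of H_k(q), the subgraph of G_k(q) induced on S_k,
  -- listed once via indices i < j
  IsEdgeH : Pred (Fin q × Fin q) 0ℓ
  IsEdgeH (i , j) = toℕ i < toℕ j × S k (elt i) × S k (elt j) × Adj k (elt i) (elt j)

  IsEdgeH? : Decidable IsEdgeH
  IsEdgeH? (i , j) = (toℕ i <? toℕ j) ×-dec S? k (elt i) ×-dec S? k (elt j) ×-dec Adj? k (elt i) (elt j)

  #EH : ℕ
  #EH = count IsEdgeH? (pairs q)

IsPrimePower : ℕ → Set
IsPrimePower q = ∃ λ p → ∃ λ e → Data.Nat.Primality.Prime p × 1 Data.Nat.≤ e × q ≡ p Data.Nat.^ e
  where import Data.Nat.Primality; import Data.Nat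

module Submission where

-- Under the hypotheses of the theorem, -1 is a k-th power residue: for odd q
-- because 2k ∣ q - 1 (an element z with z^((q-1)/2) ≠ 1 exists by a root
-- count and satisfies z^((q-1)/2) = -1 by Fermat, so -1 = (z^t)^k where
-- q - 1 = 2kt), for even q because F has
-- characteristic 2, so -1 = 1.  Hence the adjacency relation is symmetric.
-- Let N be the number of ordered triples of pairwise adjacent vertices.
-- Each triangle {a, b, c} is counted six times, so N = 6·K₃.  Translation
-- x ↦ x - c is a graph automorphism mapping the neighbourhood of c onto S_k,
-- so each vertex c lies in exactly as many ordered triangles as H_k(q) has
-- ordered edges, i.e. 2·#E(H_k(q)); hence N = q·2·#E(H_k(q)).

open import Defs
open import Data.Nat as ℕ using (ℕ; zero; suc; _+_; _*_; _≤_; _∸_; z≤n; s≤s)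
import Data.Nat.Properties as ℕP
open import Data.Nat.Divisibility using (_∣_; _∣?_; divides; ∣1⇒≡1)
open import Data.Nat.Primality using (Prime; euclidsLemma; prime⇒irreducible; ¬prime[1]; prime[2])
open import Data.Nat.Solver using (module +-*-Solver)
open import Data.Fin using (Fin; toℕ) renaming (zero to fzero; suc to fsuc)
import Data.Fin.Properties as FinP
open import Data.Fin.Permutation using (Permutation; permutation)
open import Data.Bool using (true; false; if_then_else_)
open import Data.Sum using (_⊎_; inj₁; inj₂)
open import Data.Product using (Σ; _×_; _,_)
open import Data.Empty using (⊥-elim)
open import Data.List using (List; []; _∷_; _++_; length; filter; map; concatMap; tabulate; allFin; replicate)
import Data.List.Properties as ListP
open import Data.List.Relation.Unary.All as All using (All; []; _∷_)
import Data.List.Relation.Unary.All.Properties as AllP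
open import Data.List.Relation.Unary.AllPairs using (AllPairs; []; _∷_)
import Data.List.Relation.Unary.Unique.Propositional.Properties as UniqueP
open import Relation.Nullary using (¬_; Dec; yes; no; does)
open import Relation.Nullary.Decidable using (_×-dec_; ¬?)
open import Relation.Unary using (Pred; Decidable)
open import Relation.Binary.PropositionalEquality using (_≡_; _≢_; refl; sym; trans; cong; cong₂; subst; subst₂; module ≡-Reasoning)
open import Relation.Binary.Definitions using (tri<; tri≈; tri>)
open import Function using (_∘_)
open import Function.Bundles using (Inverse)
open import Level using (0ℓ)
open import Algebra.Bundles using (CommutativeRing; CommutativeMonoid)
import Algebra.Properties.CommutativeMonoid.Sum as MonoidSum
open import Algebra.Properties.Semiring.Sum ℕP.+-*-semiring
  using (sum; sum-cong-≗; ∑-distrib-+; ∑-comm; *-distribˡ-sum; sum-replicate-zero)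
open import Algebra.Properties.CommutativeSemigroup ℕP.*-commutativeSemigroup using (x∙yz≈y∙xz)

χ : ∀ {a} {A : Set a} → Dec A → ℕ
χ d = if does d then 1 else 0

χ-yes : ∀ {a} {A : Set a} (d : Dec A) → A → χ d ≡ 1
χ-yes (yes _) _ = refl
χ-yes (no ¬a) a = ⊥-elim (¬a a)

χ-no : ∀ {a} {A : Set a} (d : Dec A) → ¬ A → χ d ≡ 0
χ-no (yes a) ¬a = ⊥-elim (¬a a)
χ-no (no _) _ = refl

χ-cong : ∀ {a b} {A : Set a} {B : Set b} → (A → B) → (B → A) → (d : Dec A) (e : Dec B) → χ d ≡ χ e
χ-cong f g (yes a) e = sym (χ-yes e (f a))
χ-cong f g (no ¬a) e = sym (χ-no e (λ b → ¬a (g b)))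

χ-× : ∀ {a b} {A : Set a} {B : Set b} (d : Dec A) (e : Dec B) → χ (d ×-dec e) ≡ χ d * χ e
χ-× (yes _) (yes _) = refl
χ-× (yes _) (no _)  = refl
χ-× (no _)  (yes _) = refl
χ-× (no _)  (no _)  = refl

χ-¬ : ∀ {a} {A : Set a} (d : Dec A) → χ (¬? d) + χ d ≡ 1
χ-¬ (yes _) = refl
χ-¬ (no _)  = refl

sum-const : ∀ n c → sum {n} (λ _ → c) ≡ n * c
sum-const zero    c = refl
sum-const (suc n) c = cong (c +_) (sum-const n c)

sum-δ : ∀ {n} (j : Fin n) → sum (λ i → χ (i FinP.≟ j)) ≡ 1
sum-δ {suc n} fzero = cong suc (trans (sum-cong-≗ {n} λ i → χ-no (fsuc i FinP.≟ fzero) λ ()) (sum-replicate-zero n))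
sum-δ {suc n} (fsuc j) = trans (sum-cong-≗ {n} shift) (sum-δ j)
  where
  shift : ∀ i → χ (fsuc i FinP.≟ fsuc j) ≡ χ (i FinP.≟ j)
  shift i = χ-cong FinP.suc-injective (cong fsuc) (fsuc i FinP.≟ fsuc j) (i FinP.≟ j)

sum₂ : ∀ {n} → (Fin n → Fin n → ℕ) → ℕ
sum₂ {n} h = sum {n} λ i → sum {n} (h i)

sum₃ : ∀ {n} → (Fin n → Fin n → Fin n → ℕ) → ℕ
sum₃ {n} h = sum {n} λ i → sum₂ (h i)

sum₂-cong : ∀ {n} {f g : Fin n → Fin n → ℕ} → (∀ i j → f i j ≡ g i j) → sum₂ f ≡ sum₂ g
sum₂-cong {n} e = sum-cong-≗ {n} λ i → sum-cong-≗ {n} (e i)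

sum₃-cong : ∀ {n} {f g : Fin n → Fin n → Fin n → ℕ} → (∀ i j l → f i j l ≡ g i j l) → sum₃ f ≡ sum₃ g
sum₃-cong {n} e = sum-cong-≗ {n} λ i → sum₂-cong (e i)

sum₂-+ : ∀ {n} (f g : Fin n → Fin n → ℕ) → sum₂ (λ i j → f i j + g i j) ≡ sum₂ f + sum₂ g
sum₂-+ {n} f g = trans (sum-cong-≗ {n} λ i → ∑-distrib-+ (f i) (g i)) (∑-distrib-+ (λ i → sum (f i)) (λ i → sum (g i)))

sum₃-+ : ∀ {n} (f g : Fin n → Fin n → Fin n → ℕ) → sum₃ (λ i j l → f i j l + g i j l) ≡ sum₃ f + sum₃ g
sum₃-+ {n} f g = trans (sum-cong-≗ {n} λ i → sum₂-+ (f i) (g i)) (∑-distrib-+ (λ i → sum₂ (f i)) (λ i → sum₂ (g i)))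

-- Ordered versus unordered pairs and triples

⟦_<_⟧ : ℕ → ℕ → ℕ
⟦ x < y ⟧ = χ (x ℕ.<? y)

⟦_≺_⟧ : ∀ {n} → Fin n → Fin n → ℕ
⟦ i ≺ j ⟧ = ⟦ toℕ i < toℕ j ⟧

<-yes : ∀ {x y} → x ℕ.< y → ⟦ x < y ⟧ ≡ 1
<-yes {x} {y} = χ-yes (x ℕ.<? y)

<-no : ∀ {x y} → ¬ x ℕ.< y → ⟦ x < y ⟧ ≡ 0
<-no {x} {y} = χ-no (x ℕ.<? y)

<-dichotomy : ∀ {x y} → x ≢ y → ⟦ x < y ⟧ + ⟦ y < x ⟧ ≡ 1
<-dichotomy {x} {y} x≢y with ℕP.<-cmp x y
... | tri< x<y _ y≮x = cong₂ _+_ (<-yes x<y) (<-no y≮x)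
... | tri≈ _ x≡y _   = ⊥-elim (x≢y x≡y)
... | tri> x≮y _ y<x = cong₂ _+_ (<-no x≮y) (<-yes y<x)

-- Once the five indicators occurring below are known, the identity is a closed computation.
private
  instantiate₅ : ∀ {a b c d e va vb vc vd ve : ℕ} → a ≡ va → b ≡ vb → c ≡ vc → d ≡ vd → e ≡ ve →
                 va ≡ va * vb + vc * vd + ve * va → a ≡ a * b + c * d + e * a
  instantiate₅ refl refl refl refl refl h = h

<-trichotomy₃ : ∀ {x y z} → x ≢ y → y ≢ z → x ≢ z →
  ⟦ x < y ⟧ ≡ ⟦ x < y ⟧ * ⟦ y < z ⟧ + ⟦ x < z ⟧ * ⟦ z < y ⟧ + ⟦ z < x ⟧ * ⟦ x < y ⟧
<-trichotomy₃ {x} {y} {z} x≢y y≢z x≢z with ℕP.<-cmp x y | ℕP.<-cmp y z | ℕP.<-cmp x z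
... | tri≈ _ x≡y _ | _ | _ = ⊥-elim (x≢y x≡y)
... | _ | tri≈ _ y≡z _ | _ = ⊥-elim (y≢z y≡z)
... | _ | _ | tri≈ _ x≡z _ = ⊥-elim (x≢z x≡z)
... | tri< x<y _ _ | tri< y<z _ _ | tri> _ _ z<x = ⊥-elim (ℕP.<-asym (ℕP.<-trans x<y y<z) z<x)
... | tri> _ _ y<x | tri> _ _ z<y | tri< x<z _ _ = ⊥-elim (ℕP.<-asym (ℕP.<-trans z<y y<x) x<z)
... | tri< a _ _ | tri< b _ d | tri< c _ e = instantiate₅ (<-yes a) (<-yes b) (<-yes c) (<-no d) (<-no e) refl
... | tri< a _ _ | tri> b _ d | tri< c _ e = instantiate₅ (<-yes a) (<-no b) (<-yes c) (<-yes d) (<-no e) refl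
... | tri< a _ _ | tri> b _ d | tri> c _ e = instantiate₅ (<-yes a) (<-no b) (<-no c) (<-yes d) (<-yes e) refl
... | tri> a _ _ | tri< b _ d | tri< c _ e = instantiate₅ (<-no a) (<-yes b) (<-yes c) (<-no d) (<-no e) refl
... | tri> a _ _ | tri< b _ d | tri> c _ e = instantiate₅ (<-no a) (<-yes b) (<-no c) (<-no d) (<-yes e) refl
... | tri> a _ _ | tri> b _ d | tri> c _ e = instantiate₅ (<-no a) (<-no b) (<-no c) (<-yes d) (<-yes e) refl

*-cong-on-support : ∀ {a b t : ℕ} → (t ≢ 0 → a ≡ b) → a * t ≡ b * t
*-cong-on-support {a} {b} {zero}  _ = trans (ℕP.*-zeroʳ a) (sym (ℕP.*-zeroʳ b))
*-cong-on-support {t = suc t} a≡b = cong (_* suc t) (a≡b λ ())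

distinct-positions : ∀ {n} {i j : Fin n} → i ≢ j → toℕ i ≢ toℕ j
distinct-positions i≢j e = i≢j (FinP.toℕ-injective e)

sum-over-pairs : ∀ {n} (h : Fin n → Fin n → ℕ) → (∀ i j → h i j ≡ h j i) → (∀ i → h i i ≡ 0) →
  sum₂ h ≡ 2 * sum₂ (λ i j → ⟦ i ≺ j ⟧ * h i j)
sum-over-pairs {n} h h-sym h-diag = begin
  sum₂ h                                          ≡⟨ sum₂-cong split ⟩
  sum₂ (λ i j → ⟦ i ≺ j ⟧ * h i j + ⟦ j ≺ i ⟧ * h j i) ≡⟨ sum₂-+ (λ i j → ⟦ i ≺ j ⟧ * h i j) _ ⟩
  H + sum₂ (λ i j → ⟦ j ≺ i ⟧ * h j i)            ≡⟨ cong (H +_) (∑-comm (λ i j → ⟦ j ≺ i ⟧ * h j i)) ⟩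
  H + H                                           ≡⟨ cong (H +_) (sym (ℕP.+-identityʳ H)) ⟩
  2 * H                                           ∎
  where
  open ≡-Reasoning
  H : ℕ
  H = sum₂ (λ i j → ⟦ i ≺ j ⟧ * h i j)
  split : ∀ i j → h i j ≡ ⟦ i ≺ j ⟧ * h i j + ⟦ j ≺ i ⟧ * h j i
  split i j = begin
    h i j                                   ≡⟨ sym (ℕP.*-identityˡ (h i j)) ⟩
    1 * h i j                               ≡⟨ *-cong-on-support (sym ∘ one-smaller) ⟩
    (⟦ i ≺ j ⟧ + ⟦ j ≺ i ⟧) * h i j         ≡⟨ ℕP.*-distribʳ-+ (h i j) ⟦ i ≺ j ⟧ ⟦ j ≺ i ⟧ ⟩
    ⟦ i ≺ j ⟧ * h i j + ⟦ j ≺ i ⟧ * h i j   ≡⟨ cong (λ v → ⟦ i ≺ j ⟧ * h i j + ⟦ j ≺ i ⟧ * v) (h-sym i j) ⟩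
    ⟦ i ≺ j ⟧ * h i j + ⟦ j ≺ i ⟧ * h j i   ∎
    where
    one-smaller : h i j ≢ 0 → ⟦ i ≺ j ⟧ + ⟦ j ≺ i ⟧ ≡ 1
    one-smaller hij≢0 = <-dichotomy (distinct-positions {i = i} {j} λ { refl → hij≢0 (h-diag i) })

sum-over-triples : ∀ {n} (T : Fin n → Fin n → Fin n → ℕ) →
  (∀ i j l → T i j l ≡ T j i l) → (∀ i j l → T i j l ≡ T i l j) → (∀ i l → T i i l ≡ 0) →
  sum₃ T ≡ 6 * sum₃ (λ i j l → ⟦ i ≺ j ⟧ * ⟦ j ≺ l ⟧ * T i j l)
sum-over-triples {n} T swap₁₂ swap₂₃ diag = begin
  sum₃ T                                          ≡⟨ sum-over-pairs (λ i j → sum (T i j)) (λ i j → sum-cong-≗ {n} (swap₁₂ i j))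
                                                                    (λ i → trans (sum-cong-≗ {n} (diag i)) (sum-replicate-zero n)) ⟩
  2 * sum₂ (λ i j → ⟦ i ≺ j ⟧ * sum (T i j))      ≡⟨ cong (2 *_) (sum₂-cong λ i j → *-distribˡ-sum ⟦ i ≺ j ⟧ (T i j)) ⟩
  2 * sum₃ (λ i j l → ⟦ i ≺ j ⟧ * T i j l)        ≡⟨ cong (2 *_) (sum₃-cong split) ⟩
  2 * sum₃ (λ i j l → X i j l + Y i j l + Z i j l) ≡⟨ cong (2 *_) (trans (sum₃-+ (λ i j l → X i j l + Y i j l) Z) (cong (_+ sum₃ Z) (sum₃-+ X Y))) ⟩
  2 * (K + sum₃ Y + sum₃ Z)                       ≡⟨ cong₂ (λ u v → 2 * (K + u + v)) Y-sum Z-sum ⟩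
  2 * (K + K + K)                                 ≡⟨ solve 1 (λ k → con 2 :* (k :+ k :+ k) := con 6 :* k) refl K ⟩
  6 * K                                           ∎
  where
  open ≡-Reasoning
  open +-*-Solver using (solve; _:*_; _:+_; _:=_; con)
  -- the three ways of placing l relative to i < j
  X Y Z : Fin n → Fin n → Fin n → ℕ
  X i j l = ⟦ i ≺ j ⟧ * ⟦ j ≺ l ⟧ * T i j l
  Y i j l = ⟦ i ≺ l ⟧ * ⟦ l ≺ j ⟧ * T i j l
  Z i j l = ⟦ l ≺ i ⟧ * ⟦ i ≺ j ⟧ * T i j l
  K : ℕ
  K = sum₃ X
  distinct : ∀ i j l → T i j l ≢ 0 → (i ≢ j) × (j ≢ l) × (i ≢ l)
  distinct i j l T≢0 =
    (λ { refl → T≢0 (diag i l) }) ,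
    (λ { refl → T≢0 (trans (swap₁₂ i j j) (trans (swap₂₃ j i j) (diag j i))) }) ,
    (λ { refl → T≢0 (trans (swap₂₃ i j i) (diag i j)) })
  split : ∀ i j l → ⟦ i ≺ j ⟧ * T i j l ≡ X i j l + Y i j l + Z i j l
  split i j l = trans (*-cong-on-support {t = T i j l} orderings)
    (trans (ℕP.*-distribʳ-+ (T i j l) (⟦ i ≺ j ⟧ * ⟦ j ≺ l ⟧ + ⟦ i ≺ l ⟧ * ⟦ l ≺ j ⟧) (⟦ l ≺ i ⟧ * ⟦ i ≺ j ⟧))
           (cong (_+ Z i j l) (ℕP.*-distribʳ-+ (T i j l) (⟦ i ≺ j ⟧ * ⟦ j ≺ l ⟧) (⟦ i ≺ l ⟧ * ⟦ l ≺ j ⟧))))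
    where
    orderings : T i j l ≢ 0 → ⟦ i ≺ j ⟧ ≡ ⟦ i ≺ j ⟧ * ⟦ j ≺ l ⟧ + ⟦ i ≺ l ⟧ * ⟦ l ≺ j ⟧ + ⟦ l ≺ i ⟧ * ⟦ i ≺ j ⟧
    orderings T≢0 with distinct i j l T≢0
    ... | i≢j , j≢l , i≢l = <-trichotomy₃ (distinct-positions i≢j) (distinct-positions j≢l) (distinct-positions i≢l)
  -- Y and Z are X with the summation variables renamed
  Y-sum : sum₃ Y ≡ K
  Y-sum = begin
    sum₃ Y                          ≡⟨ sum-cong-≗ {n} (λ i → ∑-comm (Y i)) ⟩
    sum₃ (λ i l j → Y i j l)        ≡⟨ sum₃-cong (λ i l j → cong (⟦ i ≺ l ⟧ * ⟦ l ≺ j ⟧ *_) (swap₂₃ i j l)) ⟩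
    K                               ∎
  Z-sum : sum₃ Z ≡ K
  Z-sum = begin
    sum₃ Z                          ≡⟨ sum-cong-≗ {n} (λ i → ∑-comm (Z i)) ⟩
    sum₃ (λ i l j → Z i j l)        ≡⟨ ∑-comm (λ i l → sum (λ j → Z i j l)) ⟩
    sum₃ (λ l i j → Z i j l)        ≡⟨ sum₃-cong (λ l i j → cong (⟦ l ≺ i ⟧ * ⟦ i ≺ j ⟧ *_) (sym (trans (swap₁₂ l i j) (swap₂₃ i l j)))) ⟩
    K                               ∎

count-cons : ∀ {A : Set} {P : Pred A 0ℓ} (P? : Decidable P) x xs → count P? (x ∷ xs) ≡ χ (P? x) + count P? xs
count-cons P? x xs with does (P? x)
... | true  = refl
... | false = refl

count-tabulate : ∀ {A : Set} {P : Pred A 0ℓ} (P? : Decidable P) {n} (f : Fin n → A) →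
  count P? (tabulate f) ≡ sum (λ i → χ (P? (f i)))
count-tabulate P? {zero}  f = refl
count-tabulate P? {suc n} f = trans (count-cons P? (f fzero) _) (cong (χ (P? (f fzero)) +_) (count-tabulate P? (f ∘ fsuc)))

count-concatMap-tabulate : ∀ {A B : Set} {P : Pred A 0ℓ} (P? : Decidable P) {n} (G : B → List A) (f : Fin n → B) →
  count P? (concatMap G (tabulate f)) ≡ sum (λ i → count P? (G (f i)))
count-concatMap-tabulate P? {zero}  G f = refl
count-concatMap-tabulate {A} P? {suc n} G f = begin
  length (filter P? (G (f fzero) ++ rest))          ≡⟨ cong length (ListP.filter-++ P? (G (f fzero)) rest) ⟩
  length (filter P? (G (f fzero)) ++ filter P? rest) ≡⟨ ListP.length-++ (filter P? (G (f fzero))) ⟩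
  count P? (G (f fzero)) + count P? rest            ≡⟨ cong (count P? (G (f fzero)) +_) (count-concatMap-tabulate P? G (f ∘ fsuc)) ⟩
  sum (λ i → count P? (G (f i)))                    ∎
  where
  open ≡-Reasoning
  rest : List A
  rest = concatMap G (tabulate (f ∘ fsuc))

count-map-allFin : ∀ {A : Set} {P : Pred A 0ℓ} (P? : Decidable P) {n} (f : Fin n → A) →
  count P? (map f (allFin n)) ≡ sum (λ i → χ (P? (f i)))
count-map-allFin P? {n} f = trans (cong (count P?) (ListP.map-tabulate (λ i → i) f)) (count-tabulate P? f)

count-pairs : ∀ {n} {P : Pred (Fin n × Fin n) 0ℓ} (P? : Decidable P) →
  count P? (pairs n) ≡ sum₂ (λ i j → χ (P? (i , j)))
count-pairs {n} P? = trans (count-concatMap-tabulate P? (λ i → map (i ,_) (allFin n)) (λ i → i))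
                           (sum-cong-≗ {n} λ i → count-map-allFin P? (i ,_))

count-triples : ∀ {n} {P : Pred (Fin n × Fin n × Fin n) 0ℓ} (P? : Decidable P) →
  count P? (triples n) ≡ sum₃ (λ i j l → χ (P? (i , j , l)))
count-triples {n} P? = trans (count-concatMap-tabulate P? (λ i → concatMap (λ j → map (λ l → i , j , l) (allFin n)) (allFin n)) (λ i → i))
  (sum-cong-≗ {n} λ i → trans (count-concatMap-tabulate P? (λ j → map (λ l → i , j , l) (allFin n)) (λ j → j))
  (sum-cong-≗ {n} λ j → count-map-allFin P? (λ l → i , j , l)))

prime∣^⇒prime∣ : ∀ {r} p e → Prime r → r ∣ p ℕ.^ e → r ∣ p
prime∣^⇒prime∣ p zero    r-prime r∣1 = ⊥-elim (¬prime[1] (subst Prime (∣1⇒≡1 r∣1) r-prime))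
prime∣^⇒prime∣ p (suc e) r-prime r∣pᵉ⁺¹ with euclidsLemma p (p ℕ.^ e) r-prime r∣pᵉ⁺¹
... | inj₁ r∣p  = r∣p
... | inj₂ r∣pᵉ = prime∣^⇒prime∣ p e r-prime r∣pᵉ

even-prime-power : ∀ {p} e → Prime p → 2 ∣ p ℕ.^ e → p ≡ 2
even-prime-power {p} e p-prime 2∣pᵉ with prime⇒irreducible p-prime (prime∣^⇒prime∣ p e prime[2] 2∣pᵉ)
... | inj₁ ()
... | inj₂ 2≡p = sym 2≡p

module FieldFacts {q : ℕ} (𝔽 : FiniteField q) where
  open FiniteField 𝔽 renaming (_+_ to _⊕_; _*_ to _·_)

  ring : CommutativeRing 0ℓ 0ℓ
  ring = record { isCommutativeRing = isCommutativeRing }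

  open CommutativeRing ring
    using (+-identityˡ; +-identityʳ; *-identityˡ; *-identityʳ; zeroˡ; zeroʳ; +-assoc; *-assoc; *-comm; -‿inverseʳ; -‿inverseˡ)
  open import Algebra.Solver.Ring.NaturalCoefficients.Default (CommutativeRing.commutativeSemiring ring)
    using (solve; _:+_; _:*_; _:=_)
  open import Algebra.Properties.Group (CommutativeRing.+-group ring)
    using (∙-cancelʳ; //-rightDividesˡ; //-rightDividesʳ; inverseˡ-unique; x∙y⁻¹≈ε⇒x≈y; ⁻¹-involutive; ε⁻¹≈ε)
  open import Algebra.Properties.AbelianGroup (CommutativeRing.+-abelianGroup ring) using (⁻¹-anti-homo‿-)
  open import Algebra.Properties.Ring (CommutativeRing.ring ring) using (-1*x≈-x)
  open ≡-Reasoning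

  1≢0 : 1# ≢ 0#
  1≢0 e = 0≢1 (sym e)

  ·-cancelʳ : ∀ {u v w} → w ≢ 0# → u · w ≡ v · w → u ≡ v
  ·-cancelʳ {u} {v} {w} w≢0 uw≡vw with inverse w w≢0
  ... | w⁻¹ , ww⁻¹≡1 = begin
    u              ≡⟨ sym (*-identityʳ u) ⟩
    u · 1#         ≡⟨ cong (u ·_) (sym ww⁻¹≡1) ⟩
    u · (w · w⁻¹)  ≡⟨ sym (*-assoc u w w⁻¹) ⟩
    (u · w) · w⁻¹  ≡⟨ cong (_· w⁻¹) uw≡vw ⟩
    (v · w) · w⁻¹  ≡⟨ *-assoc v w w⁻¹ ⟩
    v · (w · w⁻¹)  ≡⟨ cong (v ·_) ww⁻¹≡1 ⟩
    v · 1#         ≡⟨ *-identityʳ v ⟩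
    v              ∎

  zero-product : ∀ x y → x · y ≡ 0# → x ≡ 0# ⊎ y ≡ 0#
  zero-product x y xy≡0 with y ≟ 0#
  ... | yes y≡0 = inj₂ y≡0
  ... | no  y≢0 = inj₁ (·-cancelʳ y≢0 (trans xy≡0 (sym (zeroˡ y))))

  ·-nonzero : ∀ {x y} → x ≢ 0# → y ≢ 0# → x · y ≢ 0#
  ·-nonzero {x} {y} x≢0 y≢0 xy≡0 with zero-product x y xy≡0
  ... | inj₁ x≡0 = x≢0 x≡0
  ... | inj₂ y≡0 = y≢0 y≡0

  square-root-of-one : ∀ w → w · w ≡ 1# → w ≡ 1# ⊎ w ≡ - 1#
  square-root-of-one w w²≡1 with zero-product (w ⊕ 1#) (w - 1#) factorisation
    where
    factorisation : (w ⊕ 1#) · (w - 1#) ≡ 0#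
    factorisation = begin
      (w ⊕ 1#) · (w ⊕ - 1#)                       ≡⟨ solve 3 (λ w o m → (w :+ o) :* (w :+ m) := (w :* w :+ o :* m) :+ w :* (o :+ m)) refl w 1# (- 1#) ⟩
      (w · w ⊕ 1# · - 1#) ⊕ w · (1# ⊕ - 1#)       ≡⟨ cong₂ (λ a b → (a ⊕ 1# · - 1#) ⊕ w · b) w²≡1 (-‿inverseʳ 1#) ⟩
      (1# ⊕ 1# · - 1#) ⊕ w · 0#                   ≡⟨ cong₂ (λ a b → (1# ⊕ a) ⊕ b) (*-identityˡ (- 1#)) (zeroʳ w) ⟩
      (1# ⊕ - 1#) ⊕ 0#                            ≡⟨ trans (+-identityʳ _) (-‿inverseʳ 1#) ⟩
      0#                                          ∎
  ... | inj₁ w+1≡0 = inj₂ (inverseˡ-unique w 1# w+1≡0)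
  ... | inj₂ w-1≡0 = inj₁ (x∙y⁻¹≈ε⇒x≈y w 1# w-1≡0)

  ^-+ : ∀ x m n → x ^ (m + n) ≡ x ^ m · x ^ n
  ^-+ x zero    n = sym (*-identityˡ _)
  ^-+ x (suc m) n = trans (cong (x ·_) (^-+ x m n)) (sym (*-assoc x _ _))

  1^ : ∀ n → 1# ^ n ≡ 1#
  1^ zero    = refl
  1^ (suc n) = trans (cong (1# ·_) (1^ n)) (*-identityˡ 1#)

  ·-^ : ∀ x y n → (x · y) ^ n ≡ x ^ n · y ^ n
  ·-^ x y zero    = sym (*-identityˡ 1#)
  ·-^ x y (suc n) = trans (cong ((x · y) ·_) (·-^ x y n))
    (solve 4 (λ x y a b → (x :* y) :* (a :* b) := (x :* a) :* (y :* b)) refl x y (x ^ n) (y ^ n))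

  ^-* : ∀ x m n → x ^ (m * n) ≡ (x ^ m) ^ n
  ^-* x zero    n = sym (1^ n)
  ^-* x (suc m) n = begin
    x ^ (n + m * n)        ≡⟨ ^-+ x n (m * n) ⟩
    x ^ n · x ^ (m * n)    ≡⟨ cong (x ^ n ·_) (^-* x m n) ⟩
    x ^ n · (x ^ m) ^ n    ≡⟨ sym (·-^ x (x ^ m) n) ⟩
    (x · x ^ m) ^ n        ∎

  ^-nonzero : ∀ {x} n → x ≢ 0# → x ^ n ≢ 0#
  ^-nonzero zero    _   = 1≢0
  ^-nonzero (suc n) x≢0 = ·-nonzero x≢0 (^-nonzero n x≢0)

  S-· : ∀ k {x y} → S k x → S k y → S k (x · y)
  S-· k (x≢0 , a , aᵏ≡x) (y≢0 , b , bᵏ≡y) = ·-nonzero x≢0 y≢0 , a · b , trans (·-^ a b k) (cong₂ _·_ aᵏ≡x bᵏ≡y)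

  S-neg : ∀ k → S k (- 1#) → ∀ {x} → S k x → S k (- x)
  S-neg k -1∈S {x} x∈S = subst (S k) (-1*x≈-x x) (S-· k -1∈S x∈S)

  Adj-sym : ∀ k → S k (- 1#) → ∀ {a b} → Adj k a b → Adj k b a
  Adj-sym k -1∈S {a} {b} a~b = subst (S k) (⁻¹-anti-homo‿- a b) (S-neg k -1∈S a~b)

  Adj-irrefl : ∀ k a → ¬ Adj k a a
  Adj-irrefl k a (a-a≢0 , _) = a-a≢0 (-‿inverseʳ a)

  shift-difference : ∀ x y c → (x ⊕ c) - (y ⊕ c) ≡ x - y
  shift-difference x y c = ∙-cancelʳ (y ⊕ c) _ _ (begin
    ((x ⊕ c) - (y ⊕ c)) ⊕ (y ⊕ c) ≡⟨ //-rightDividesˡ (y ⊕ c) (x ⊕ c) ⟩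
    x ⊕ c                         ≡⟨ cong (_⊕ c) (sym (//-rightDividesˡ y x)) ⟩
    ((x - y) ⊕ y) ⊕ c             ≡⟨ +-assoc (x - y) y c ⟩
    (x - y) ⊕ (y ⊕ c)             ∎)

  shift-difference₀ : ∀ x c → c - (x ⊕ c) ≡ - x
  shift-difference₀ x c = begin
    c - (x ⊕ c)         ≡⟨ cong (_- (x ⊕ c)) (sym (+-identityˡ c)) ⟩
    (0# ⊕ c) - (x ⊕ c)  ≡⟨ shift-difference 0# x c ⟩
    0# - x              ≡⟨ +-identityˡ (- x) ⟩
    - x                 ∎


  permutationOf : (f g : F → F) → (∀ x → g (f x) ≡ x) → (∀ x → f (g x) ≡ x) → Permutation q q
  permutationOf f g gf fg = permutation (λ i → idx (f (elt i))) (λ i → idx (g (elt i)))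
    (λ i → trans (cong (idx ∘ f) (elt∘idx _)) (trans (cong idx (fg _)) (idx∘elt i)))
    (λ i → trans (cong (idx ∘ g) (elt∘idx _)) (trans (cong idx (gf _)) (idx∘elt i)))
    where
    elt∘idx : ∀ x → elt (idx x) ≡ x
    elt∘idx = Inverse.strictlyInverseˡ enum
    idx∘elt : ∀ i → idx (elt i) ≡ i
    idx∘elt = Inverse.strictlyInverseʳ enum

  module Reindex (M : CommutativeMonoid 0ℓ 0ℓ) where
    open CommutativeMonoid M using (Carrier; _≈_) renaming (trans to ≈-trans; reflexive to ≈-reflexive)
    open MonoidSum M using (sum-permute) renaming (sum to ∑; sum-cong-≗ to ∑-cong)

    reindex : (f g : F → F) → (∀ x → g (f x) ≡ x) → (∀ x → f (g x) ≡ x) → (h : F → Carrier) →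
              ∑ (λ i → h (elt i)) ≈ ∑ (λ i → h (f (elt i)))
    reindex f g gf fg h = ≈-trans (sum-permute (λ i → h (elt i)) (permutationOf f g gf fg))
      (≈-reflexive (∑-cong {q} λ i → cong h (Inverse.strictlyInverseˡ enum (f (elt i)))))

  translate-sum : ∀ c (h : F → ℕ) → sum (λ i → h (elt i)) ≡ sum (λ i → h (elt i ⊕ c))
  translate-sum c = Reindex.reindex ℕP.+-0-commutativeMonoid (_⊕ c) (_- c) (//-rightDividesʳ c) (//-rightDividesˡ c)

  -- Fermat's little theorem

  ifZero_then_else_ : F → F → F → F
  ifZero x then a else b with x ≟ 0#
  ... | yes _ = a
  ... | no  _ = b

  ifZero-yes : ∀ {x} a b → x ≡ 0# → (ifZero x then a else b) ≡ a
  ifZero-yes {x} a b x≡0 with x ≟ 0#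
  ... | yes _   = refl
  ... | no  x≢0 = ⊥-elim (x≢0 x≡0)

  ifZero-no : ∀ {x} a b → x ≢ 0# → (ifZero x then a else b) ≡ b
  ifZero-no {x} a b x≢0 with x ≟ 0#
  ... | yes x≡0 = ⊥-elim (x≢0 x≡0)
  ... | no  _   = refl

  nonzeroPart : F → F
  nonzeroPart x = ifZero x then 1# else x

  nonzeroPart-nonzero : ∀ x → nonzeroPart x ≢ 0#
  nonzeroPart-nonzero x with x ≟ 0#
  ... | yes _   = 1≢0
  ... | no  x≢0 = x≢0

  nonzeroPart-· : ∀ z → z ≢ 0# → ∀ x → nonzeroPart (z · x) ≡ (ifZero x then 1# else z) · nonzeroPart x
  nonzeroPart-· z z≢0 x with x ≟ 0#
  ... | yes x≡0 = trans (ifZero-yes 1# (z · x) (trans (cong (z ·_) x≡0) (zeroʳ z))) (sym (*-identityˡ 1#))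
  ... | no  x≢0 = ifZero-no 1# (z · x) (·-nonzero z≢0 x≢0)

  open MonoidSum (CommutativeRing.*-commutativeMonoid ring) using ()
    renaming (sum to product; sum-cong-≗ to product-cong; ∑-distrib-+ to product-distrib-·)

  #nonzero : ∀ {n} → (Fin n → F) → ℕ
  #nonzero v = sum (λ i → χ (¬? (v i ≟ 0#)))

  product-of-weights : ∀ z {n} (v : Fin n → F) → product (λ i → ifZero v i then 1# else z) ≡ z ^ #nonzero v
  product-of-weights z {zero}  v = refl
  product-of-weights z {suc n} v =
    trans (cong (weight (v fzero) ·_) (product-of-weights z (v ∘ fsuc))) (first-factor (v fzero ≟ 0#))
    where
    weight : F → F
    weight x = ifZero x then 1# else z
    rest : F
    rest = z ^ #nonzero (v ∘ fsuc)
    first-factor : (d : Dec (v fzero ≡ 0#)) → weight (v fzero) · rest ≡ z ^ (χ (¬? d) + #nonzero (v ∘ fsuc))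
    first-factor (yes v₀≡0) = trans (cong (_· rest) (ifZero-yes 1# z v₀≡0)) (*-identityˡ rest)
    first-factor (no  v₀≢0) = cong (_· rest) (ifZero-no 1# z v₀≢0)

  product-nonzero : ∀ {n} (v : Fin n → F) → (∀ i → v i ≢ 0#) → product v ≢ 0#
  product-nonzero {zero}  v _       = 1≢0
  product-nonzero {suc n} v v≢0 = ·-nonzero (v≢0 fzero) (product-nonzero (v ∘ fsuc) (v≢0 ∘ fsuc))

  #nonzero-elements : #nonzero elt ≡ q ∸ 1
  #nonzero-elements = trans (sym (ℕP.m+n∸n≡m (#nonzero elt) 1)) (cong (_∸ 1) (begin
    #nonzero elt + 1                                          ≡⟨ cong (#nonzero elt +_) (sym exactly-one-zero) ⟩
    #nonzero elt + sum (λ i → χ (elt i ≟ 0#))                 ≡⟨ sym (∑-distrib-+ (λ i → χ (¬? (elt i ≟ 0#))) _) ⟩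
    sum (λ i → χ (¬? (elt i ≟ 0#)) + χ (elt i ≟ 0#))          ≡⟨ sum-cong-≗ {q} (λ i → χ-¬ (elt i ≟ 0#)) ⟩
    sum {q} (λ _ → 1)                                         ≡⟨ trans (sum-const q 1) (ℕP.*-identityʳ q) ⟩
    q                                                         ∎))
    where
    exactly-one-zero : sum (λ i → χ (elt i ≟ 0#)) ≡ 1
    exactly-one-zero = trans (sum-cong-≗ {q} λ i → χ-cong (λ e → trans (sym (Inverse.strictlyInverseʳ enum i)) (cong idx e))
                                                  (λ e → trans (cong elt e) (Inverse.strictlyInverseˡ enum 0#))
                                                  (elt i ≟ 0#) (i FinP.≟ idx 0#))
                     (sum-δ (idx 0#))

  -- z^(q-1) = 1 for z ≠ 0: multiplying every element by z permutes F, so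
  -- z^(q-1) · P = P for the nonzero product P of the nonzero parts
  fermat : ∀ z → z ≢ 0# → z ^ (q ∸ 1) ≡ 1#
  fermat z z≢0 with inverse z z≢0
  ... | z⁻¹ , zz⁻¹≡1 = subst (λ n → z ^ n ≡ 1#) #nonzero-elements
                              (·-cancelʳ (product-nonzero (nonzeroPart ∘ elt) (nonzeroPart-nonzero ∘ elt)) scaled)
    where
    open Reindex (CommutativeRing.*-commutativeMonoid ring) using (reindex)
    P : F
    P = product (λ i → nonzeroPart (elt i))
    z⁻¹z : ∀ x → z⁻¹ · (z · x) ≡ x
    z⁻¹z x = trans (sym (*-assoc z⁻¹ z x)) (trans (cong (_· x) (trans (*-comm z⁻¹ z) zz⁻¹≡1)) (*-identityˡ x))
    zz⁻¹ : ∀ x → z · (z⁻¹ · x) ≡ x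
    zz⁻¹ x = trans (sym (*-assoc z z⁻¹ x)) (trans (cong (_· x) zz⁻¹≡1) (*-identityˡ x))
    scaled : z ^ #nonzero elt · P ≡ 1# · P
    scaled = begin
      z ^ #nonzero elt · P                                    ≡⟨ cong (_· P) (sym (product-of-weights z elt)) ⟩
      product (λ i → ifZero elt i then 1# else z) · P         ≡⟨ sym (product-distrib-· (λ i → ifZero elt i then 1# else z) (nonzeroPart ∘ elt)) ⟩
      product (λ i → (ifZero elt i then 1# else z) · nonzeroPart (elt i)) ≡⟨ sym (product-cong {q} (nonzeroPart-· z z≢0 ∘ elt)) ⟩
      product (λ i → nonzeroPart (z · elt i))                 ≡⟨ sym (reindex (z ·_) (z⁻¹ ·_) z⁻¹z zz⁻¹ nonzeroPart) ⟩
      P                                                       ≡⟨ sym (*-identityˡ P) ⟩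
      1# · P                                                  ∎

  -- Monic polynomials have few roots

  -- c₀ ∷ c₁ ∷ … ∷ cₙ₋₁ represents the monic polynomial c₀ + c₁x + … + cₙ₋₁xⁿ⁻¹ + xⁿ of degree n
  evalMonic : List F → F → F
  evalMonic []       x = 1#
  evalMonic (c ∷ cs) x = c ⊕ x · evalMonic cs x

  -- division by x - a: P(x) - P(a) = (x - a)·Q(x) with Q monic of one degree less,
  -- written additively as P(x) + a·Q(x) = x·Q(x) + P(a)
  divide-by-linear : ∀ c cs a → Σ (List F) λ qs → length qs ≡ length cs ×
    (∀ x → evalMonic (c ∷ cs) x ⊕ a · evalMonic qs x ≡ x · evalMonic qs x ⊕ evalMonic (c ∷ cs) a)
  divide-by-linear c [] a = [] , refl , λ x →
    solve 4 (λ c x a o → (c :+ x :* o) :+ a :* o := x :* o :+ (c :+ a :* o)) refl c x a 1#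
  divide-by-linear c (c′ ∷ cs) a with divide-by-linear c′ cs a
  ... | qs , len , division = evalMonic (c′ ∷ cs) a ∷ qs , cong suc len , λ x →
    let Px = evalMonic (c′ ∷ cs) x ; Pa = evalMonic (c′ ∷ cs) a ; Qx = evalMonic qs x in begin
    (c ⊕ x · Px) ⊕ a · (Pa ⊕ x · Qx)  ≡⟨ solve 6 (λ c x Px a Pa Qx → (c :+ x :* Px) :+ a :* (Pa :+ x :* Qx) := (c :+ a :* Pa) :+ x :* (Px :+ a :* Qx)) refl c x Px a Pa Qx ⟩
    (c ⊕ a · Pa) ⊕ x · (Px ⊕ a · Qx)  ≡⟨ cong (λ t → (c ⊕ a · Pa) ⊕ x · t) (division x) ⟩
    (c ⊕ a · Pa) ⊕ x · (x · Qx ⊕ Pa)  ≡⟨ solve 5 (λ c x a Pa Qx → (c :+ a :* Pa) :+ x :* (x :* Qx :+ Pa) := x :* (Pa :+ x :* Qx) :+ (c :+ a :* Pa)) refl c x a Pa Qx ⟩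
    x · (Pa ⊕ x · Qx) ⊕ (c ⊕ a · Pa)  ∎

  quotient-root : ∀ (P Q : F → F) {a r} → (∀ x → P x ⊕ a · Q x ≡ x · Q x ⊕ P a) →
                  P a ≡ 0# → a ≢ r → P r ≡ 0# → Q r ≡ 0#
  quotient-root P Q {a} {r} division Pa≡0 a≢r Pr≡0 with Q r ≟ 0#
  ... | yes Qr≡0 = Qr≡0
  ... | no  Qr≢0 = ⊥-elim (a≢r (·-cancelʳ Qr≢0 (begin
    a · Q r          ≡⟨ sym (+-identityˡ (a · Q r)) ⟩
    0# ⊕ a · Q r     ≡⟨ cong (_⊕ a · Q r) (sym Pr≡0) ⟩
    P r ⊕ a · Q r    ≡⟨ division r ⟩
    r · Q r ⊕ P a    ≡⟨ cong (r · Q r ⊕_) Pa≡0 ⟩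
    r · Q r ⊕ 0#     ≡⟨ +-identityʳ (r · Q r) ⟩
    r · Q r          ∎)))

  root-bound : ∀ cs (rs : List F) → AllPairs _≢_ rs → All (λ r → evalMonic cs r ≡ 0#) rs → length rs ≤ length cs
  root-bound cs       []       _ _ = z≤n
  root-bound []       (r ∷ rs) _ (1≡0 ∷ _) = ⊥-elim (1≢0 1≡0)
  root-bound (c ∷ cs) (r ∷ rs) (r≢rs ∷ distinct) (Pr≡0 ∷ Prs≡0) with divide-by-linear c cs r
  ... | qs , len , division = s≤s (subst (length rs ≤_) len (root-bound qs rs distinct
        (All.zipWith (λ (r≢r′ , Pr′≡0) → quotient-root (evalMonic (c ∷ cs)) (evalMonic qs) division Pr≡0 r≢r′ Pr′≡0)
                     (r≢rs , Prs≡0))))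

  2≤q : 2 ≤ q
  2≤q = distinct⇒2≤ (λ e → 0≢1 (trans (sym (Inverse.strictlyInverseˡ enum 0#)) (trans (cong elt e) (Inverse.strictlyInverseˡ enum 1#))))
    where
    distinct⇒2≤ : ∀ {n} {i j : Fin n} → i ≢ j → 2 ≤ n
    distinct⇒2≤ {suc zero} {fzero} {fzero} i≢j = ⊥-elim (i≢j refl)
    distinct⇒2≤ {suc (suc n)} _ = s≤s (s≤s z≤n)

  -- If m + 2 < q, some nonzero z satisfies z^(m+1) ≠ 1: otherwise every element
  -- of F is a root of x·(x^(m+1) - 1), which has degree m + 2.
  non-root-of-unity : ∀ m → suc (suc m) ℕ.< q → Σ F λ z → z ≢ 0# × z ^ suc m ≢ 1#
  non-root-of-unity m m+2<q with FinP.any? (λ i → ¬? (elt i ≟ 0#) ×-dec ¬? ((elt i ^ suc m) ≟ 1#))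
  ... | yes (i , witness) = elt i , witness
  ... | no  none = ⊥-elim (ℕP.<⇒≱ m+2<q (subst₂ _≤_ (ListP.length-tabulate elt) (cong (suc ∘ suc) (ListP.length-replicate m))
          (root-bound P (tabulate elt) (UniqueP.tabulate⁺ elt-injective) (AllP.tabulate⁺ every-element-is-root))))
    where
    P : List F
    P = 0# ∷ - 1# ∷ replicate m 0#
    elt-injective : ∀ {i j} → elt i ≡ elt j → i ≡ j
    elt-injective {i} {j} e = trans (sym (Inverse.strictlyInverseʳ enum i)) (trans (cong idx e) (Inverse.strictlyInverseʳ enum j))
    evalMonic-monomial : ∀ n x → evalMonic (replicate n 0#) x ≡ x ^ n
    evalMonic-monomial zero    x = refl
    evalMonic-monomial (suc n) x = trans (+-identityˡ _) (cong (x ·_) (evalMonic-monomial n x))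
    root : ∀ x → x ≡ 0# ⊎ x ^ suc m ≡ 1# → evalMonic P x ≡ 0#
    root x (inj₁ refl) = trans (+-identityˡ _) (zeroˡ _)
    root x (inj₂ xᵐ⁺¹≡1) = begin
      0# ⊕ x · (- 1# ⊕ x · evalMonic (replicate m 0#) x) ≡⟨ cong (λ t → 0# ⊕ x · (- 1# ⊕ x · t)) (evalMonic-monomial m x) ⟩
      0# ⊕ x · (- 1# ⊕ x ^ suc m)                       ≡⟨ cong (λ t → 0# ⊕ x · (- 1# ⊕ t)) xᵐ⁺¹≡1 ⟩
      0# ⊕ x · (- 1# ⊕ 1#)                              ≡⟨ cong (λ t → 0# ⊕ x · t) (-‿inverseˡ 1#) ⟩
      0# ⊕ x · 0#                                       ≡⟨ trans (+-identityˡ _) (zeroʳ x) ⟩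
      0#                                                ∎
    every-element-is-root : ∀ i → evalMonic P (elt i) ≡ 0#
    every-element-is-root i with elt i ≟ 0#
    ... | yes x≡0 = root (elt i) (inj₁ x≡0)
    ... | no  x≢0 with (elt i ^ suc m) ≟ 1#
    ...   | yes xᵐ⁺¹≡1 = root (elt i) (inj₂ xᵐ⁺¹≡1)
    ...   | no  xᵐ⁺¹≢1 = ⊥-elim (none (i , x≢0 , xᵐ⁺¹≢1))

  -1≢0 : - 1# ≢ 0#
  -1≢0 -1≡0 = 1≢0 (trans (sym (⁻¹-involutive 1#)) (trans (cong -_ -1≡0) ε⁻¹≈ε))

  -- If q - 1 = 2m, then -1 is an m-th power: choose z ≠ 0 with z^m ≠ 1;
  -- then (z^m)² = z^(q-1) = 1 by Fermat, so z^m = -1.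
  minus-one-is-power : ∀ m → q ∸ 1 ≡ 2 * m → Σ F λ z → z ^ m ≡ - 1#
  minus-one-is-power zero q-1≡0 with subst (1 ≤_) q-1≡0 (ℕP.∸-monoˡ-≤ 1 2≤q)
  ... | ()
  minus-one-is-power (suc m) q-1≡2m with non-root-of-unity m m+2<q
    where
    m+2<q : suc (suc m) ℕ.< q
    m+2<q = subst (suc (suc m) ℕ.<_) (trans (cong suc (sym q-1≡2m)) (trans (ℕP.+-comm 1 (q ∸ 1)) (ℕP.m∸n+n≡m (ℕP.≤-trans (s≤s z≤n) 2≤q))))
                  (s≤s (ℕP.m<m+n (suc m) (s≤s z≤n)))
  ... | z , z≢0 , zᵐ≢1 with square-root-of-one (z ^ suc m) (begin
        z ^ suc m · z ^ suc m        ≡⟨ sym (^-+ z (suc m) (suc m)) ⟩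
        z ^ (suc m + suc m)          ≡⟨ cong (λ n → z ^ (suc m + n)) (sym (ℕP.+-identityʳ (suc m))) ⟩
        z ^ (2 * suc m)              ≡⟨ cong (z ^_) (sym q-1≡2m) ⟩
        z ^ (q ∸ 1)                  ≡⟨ fermat z z≢0 ⟩
        1#                           ∎)
  ...   | inj₁ zᵐ≡1  = ⊥-elim (zᵐ≢1 zᵐ≡1)
  ...   | inj₂ zᵐ≡-1 = z , zᵐ≡-1

  minus-one-residue-odd : ∀ k t → q ∸ 1 ≡ t * (2 * k) → S k (- 1#)
  minus-one-residue-odd k t q-1≡t2k with minus-one-is-power (t * k) q-1≡2tk
    where
    q-1≡2tk : q ∸ 1 ≡ 2 * (t * k)
    q-1≡2tk = trans q-1≡t2k (trans (ℕP.*-comm t (2 * k)) (trans (ℕP.*-assoc 2 k t) (cong (2 *_) (ℕP.*-comm k t))))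
  ... | z , zᵗᵏ≡-1 = -1≢0 , z ^ t , trans (sym (^-* z t k)) zᵗᵏ≡-1

  open import Algebra.Properties.Semiring.Mult (CommutativeRing.semiring ring) using (×1-homo-*) renaming (_×_ to _×ₙ_)
  open import Algebra.Properties.Semiring.Sum (CommutativeRing.semiring ring) using ()
    renaming (sum to ∑; ∑-distrib-+ to ∑-distrib-⊕; sum-replicate to ∑-replicate)
  open import Algebra.Properties.Group (CommutativeRing.+-group ring) using (identityʳ-unique)

  ι : ℕ → F
  ι n = n ×ₙ 1#

  -- the sum of all elements of F is invariant under x ↦ x + 1, hence ι q = 0
  ι-q : ι q ≡ 0#
  ι-q = identityʳ-unique total (ι q) (sym (begin
    total                     ≡⟨ reindex (_⊕ 1#) (_- 1#) (//-rightDividesʳ 1#) (//-rightDividesˡ 1#) (λ x → x) ⟩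
    ∑ (λ i → elt i ⊕ 1#)      ≡⟨ ∑-distrib-⊕ elt (λ _ → 1#) ⟩
    total ⊕ ∑ {q} (λ _ → 1#)  ≡⟨ cong (total ⊕_) (∑-replicate q) ⟩
    total ⊕ ι q               ∎))
    where
    open Reindex (CommutativeRing.+-commutativeMonoid ring) using (reindex)
    total : F
    total = ∑ elt

  ι-^ : ∀ p e → ι (p ℕ.^ e) ≡ ι p ^ e
  ι-^ p zero    = +-identityʳ 1#
  ι-^ p (suc e) = trans (×1-homo-* p (p ℕ.^ e)) (cong (ι p ·_) (ι-^ p e))

  -- if q = 2^e then 1 + 1 = 0, so -1 = 1 = 1^k ∈ S_k
  minus-one-residue-even : ∀ k e → q ≡ 2 ℕ.^ e → S k (- 1#)
  minus-one-residue-even k e q≡2ᵉ = -1≢0 , 1# , trans (1^ k) (inverseˡ-unique 1# 1# 1+1≡0)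
    where
    ι2≡0 : ι 2 ≡ 0#
    ι2≡0 with ι 2 ≟ 0#
    ... | yes ι2≡0 = ι2≡0
    ... | no  ι2≢0 = ⊥-elim (^-nonzero e ι2≢0 (trans (sym (ι-^ 2 e)) (trans (cong ι (sym q≡2ᵉ)) ι-q)))
    1+1≡0 : 1# ⊕ 1# ≡ 0#
    1+1≡0 = trans (cong (1# ⊕_) (sym (+-identityʳ 1#))) ι2≡0

  minus-one-residue : ∀ k → IsPrimePower q → (¬ (2 ∣ q) → (2 * k) ∣ q ∸ 1) → S k (- 1#)
  minus-one-residue k (p , e , p-prime , _ , q≡pᵉ) 2k∣q-1-if-odd with 2 ∣? q
  ... | yes 2∣q = minus-one-residue-even k e (trans q≡pᵉ (cong (ℕ._^ e) (even-prime-power e p-prime (subst (2 ∣_) q≡pᵉ 2∣q))))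
  ... | no  2∤q with 2k∣q-1-if-odd 2∤q
  ...   | divides t q-1≡t2k = minus-one-residue-odd k t q-1≡t2k

module TriangleCount {q : ℕ} (𝔽 : FiniteField q) (k : ℕ)
                     (-1∈S : FiniteField.S 𝔽 k (FiniteField.-_ 𝔽 (FiniteField.1# 𝔽))) where
  open FiniteField 𝔽 using (F; elt; S; S?; Adj; Adj?; -_) renaming (_+_ to _⊕_)
  open FieldFacts 𝔽 using (Adj-sym; Adj-irrefl; S-neg; ring; shift-difference; shift-difference₀; translate-sum)
  open import Algebra.Properties.Group (CommutativeRing.+-group ring) using (⁻¹-involutive)
  open ≡-Reasoning

  A : Fin q → Fin q → ℕ
  A i j = χ (Adj? k (elt i) (elt j))

  A-sym : ∀ i j → A i j ≡ A j i
  A-sym i j = χ-cong (Adj-sym k -1∈S) (Adj-sym k -1∈S) (Adj? k (elt i) (elt j)) (Adj? k (elt j) (elt i))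

  A-diag : ∀ i → A i i ≡ 0
  A-diag i = χ-no (Adj? k (elt i) (elt i)) (Adj-irrefl k (elt i))

  triangle : F → F → F → ℕ
  triangle u v w = χ (Adj? k u v) * (χ (Adj? k u w) * χ (Adj? k v w))

  T : Fin q → Fin q → Fin q → ℕ
  T i j l = triangle (elt i) (elt j) (elt l)

  edgeH : F → F → ℕ
  edgeH x y = χ (S? k x) * (χ (S? k y) * χ (Adj? k x y))

  E : Fin q → Fin q → ℕ
  E i j = edgeH (elt i) (elt j)

  K₃-as-sum : K₃ 𝔽 k ≡ sum₃ (λ i j l → ⟦ i ≺ j ⟧ * ⟦ j ≺ l ⟧ * T i j l)
  K₃-as-sum = trans (count-triples (IsTriangle? 𝔽 k)) (sum₃-cong factorise)
    where
    factorise : ∀ i j l → χ (IsTriangle? 𝔽 k (i , j , l)) ≡ ⟦ i ≺ j ⟧ * ⟦ j ≺ l ⟧ * T i j l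
    factorise i j l = trans (χ-× increasing adjacent) (cong₂ _*_ (χ-× (toℕ i ℕ.<? toℕ j) (toℕ j ℕ.<? toℕ l))
                        (trans (χ-× ij (il ×-dec jl)) (cong (A i j *_) (χ-× il jl))))
      where
      increasing : Dec (toℕ i ℕ.< toℕ j × toℕ j ℕ.< toℕ l)
      increasing = (toℕ i ℕ.<? toℕ j) ×-dec (toℕ j ℕ.<? toℕ l)
      ij : Dec (Adj k (elt i) (elt j))
      ij = Adj? k (elt i) (elt j)
      il : Dec (Adj k (elt i) (elt l))
      il = Adj? k (elt i) (elt l)
      jl : Dec (Adj k (elt j) (elt l))
      jl = Adj? k (elt j) (elt l)
      adjacent : Dec (Adj k (elt i) (elt j) × Adj k (elt i) (elt l) × Adj k (elt j) (elt l))
      adjacent = ij ×-dec il ×-dec jl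

  #EH-as-sum : #EH 𝔽 k ≡ sum₂ (λ i j → ⟦ i ≺ j ⟧ * E i j)
  #EH-as-sum = trans (count-pairs (IsEdgeH? 𝔽 k)) (sum₂-cong factorise)
    where
    factorise : ∀ i j → χ (IsEdgeH? 𝔽 k (i , j)) ≡ ⟦ i ≺ j ⟧ * E i j
    factorise i j = trans (χ-× (toℕ i ℕ.<? toℕ j) (si ×-dec sj ×-dec ij))
                          (cong (⟦ i ≺ j ⟧ *_) (trans (χ-× si (sj ×-dec ij)) (cong (χ si *_) (χ-× sj ij))))
      where
      si : Dec (S k (elt i))
      si = S? k (elt i)
      sj : Dec (S k (elt j))
      sj = S? k (elt j)
      ij : Dec (Adj k (elt i) (elt j))
      ij = Adj? k (elt i) (elt j)

  T-swap₁₂ : ∀ i j l → T i j l ≡ T j i l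
  T-swap₁₂ i j l = cong₂ _*_ (A-sym i j) (ℕP.*-comm (A i l) (A j l))

  T-swap₂₃ : ∀ i j l → T i j l ≡ T i l j
  T-swap₂₃ i j l = trans (x∙yz≈y∙xz (A i j) (A i l) (A j l)) (cong (λ n → A i l * (A i j * n)) (A-sym j l))

  T-diag : ∀ i l → T i i l ≡ 0
  T-diag i l = cong (_* (A i l * A i l)) (A-diag i)

  E-sym : ∀ i j → E i j ≡ E j i
  E-sym i j = trans (x∙yz≈y∙xz (χ (S? k (elt i))) (χ (S? k (elt j))) (A i j)) (cong (λ n → χ (S? k (elt j)) * (χ (S? k (elt i)) * n)) (A-sym i j))

  E-diag : ∀ i → E i i ≡ 0
  E-diag i = trans (cong (λ n → s * (s * n)) (A-diag i)) (trans (cong (s *_) (ℕP.*-zeroʳ s)) (ℕP.*-zeroʳ s))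
    where
    s : ℕ
    s = χ (S? k (elt i))

  -- translating by c: c is adjacent to x + c iff x ∈ S_k (as -1 ∈ S_k), and
  -- x + c, y + c are adjacent iff x, y are
  adjacent-to-translate : ∀ c x → χ (Adj? k c (x ⊕ c)) ≡ χ (S? k x)
  adjacent-to-translate c x = trans (cong (λ u → χ (S? k u)) (shift-difference₀ x c))
    (χ-cong (λ -x∈S → subst (S k) (⁻¹-involutive x) (S-neg k -1∈S -x∈S)) (S-neg k -1∈S) (S? k (- x)) (S? k x))

  translates-adjacent : ∀ c x y → χ (Adj? k (x ⊕ c) (y ⊕ c)) ≡ χ (Adj? k x y)
  translates-adjacent c x y = cong (λ u → χ (S? k u)) (shift-difference x y c)

  -- Every vertex c lies in equally many ordered triangles, namely as many as
  -- H_k(q) has ordered edges: translation by -c maps the neighbourhood of c onto S_k.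
  triangles-at : ∀ c → sum₂ (λ j l → triangle c (elt j) (elt l)) ≡ sum₂ E
  triangles-at c = begin
    sum₂ (λ j l → triangle c (elt j) (elt l))               ≡⟨ sum-cong-≗ {q} (λ j → translate-sum c (triangle c (elt j))) ⟩
    sum (λ j → sum (λ l → triangle c (elt j) (elt l ⊕ c)))  ≡⟨ translate-sum c (λ x → sum (λ l → triangle c x (elt l ⊕ c))) ⟩
    sum₂ (λ j l → triangle c (elt j ⊕ c) (elt l ⊕ c))       ≡⟨ sum₂-cong (λ j l → translated (elt j) (elt l)) ⟩
    sum₂ E                                                  ∎
    where
    translated : ∀ x y → triangle c (x ⊕ c) (y ⊕ c) ≡ edgeH x y
    translated x y = cong₂ _*_ (adjacent-to-translate c x) (cong₂ _*_ (adjacent-to-translate c y) (translates-adjacent c x y))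

  -- Double counting: 6·K₃ = #(ordered triangles) = q·#(ordered edges of H_k(q)) = 2q·#E(H_k(q)).
  triangle-count : 3 * K₃ 𝔽 k ≡ q * #EH 𝔽 k
  triangle-count = ℕP.*-cancelˡ-≡ (3 * K₃ 𝔽 k) (q * #EH 𝔽 k) 2 (begin
    2 * (3 * K₃ 𝔽 k)                  ≡⟨ sym (ℕP.*-assoc 2 3 (K₃ 𝔽 k)) ⟩
    6 * K₃ 𝔽 k                        ≡⟨ cong (6 *_) K₃-as-sum ⟩
    6 * sum₃ (λ i j l → ⟦ i ≺ j ⟧ * ⟦ j ≺ l ⟧ * T i j l) ≡⟨ sym (sum-over-triples T T-swap₁₂ T-swap₂₃ T-diag) ⟩
    sum₃ T                            ≡⟨ sum-cong-≗ {q} (λ i → triangles-at (elt i)) ⟩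
    sum {q} (λ _ → sum₂ E)            ≡⟨ sum-const q (sum₂ E) ⟩
    q * sum₂ E                        ≡⟨ cong (q *_) (sum-over-pairs E E-sym E-diag) ⟩
    q * (2 * sum₂ (λ i j → ⟦ i ≺ j ⟧ * E i j)) ≡⟨ cong (λ n → q * (2 * n)) (sym #EH-as-sum) ⟩
    q * (2 * #EH 𝔽 k)                 ≡⟨ x∙yz≈y∙xz q 2 (#EH 𝔽 k) ⟩
    2 * (q * #EH 𝔽 k)                 ∎)

corollary4p4 : (k q : ℕ) → 2 ≤ k → IsPrimePower q →
    (2 ∣ q → k ∣ q ∸ 1) → (¬ (2 ∣ q) → (2 * k) ∣ q ∸ 1) →
    (𝔽 : FiniteField q) →
    3 * K₃ 𝔽 k ≡ q * #EH 𝔽 k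
corollary4p4 k q _ q-prime-power _ 2k∣q-1-if-odd 𝔽 =
  TriangleCount.triangle-count 𝔽 k (FieldFacts.minus-one-residue 𝔽 k q-prime-power 2k∣q-1-if-odd)
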